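{- Let $r \in \mathbb{Z}_{\ge 0}$. Then \[ \{L_1(r), \dotsc, L_{\lceil r/2 \rceil}(r)\} = \{F_{r+2} - F_i F_j ;\ i,j \in \mathbb{Z}_{\ge 0},\ i+j = r-1\}. \] More explicitly, if $1 \le m \le \lceil \frac{r}{2} \rceil$, then \[ L_m(r) = F_{r+2} - F_{2m-2-b}\, F_{r-2m+1+b}, \] where $b = 0$ if $m \le \lfloor \frac{r+3}{4} \rfloor$ or $r$ is even, and $b = 1$ if $m > \lfloor \frac{r+3}{4} \rfloor$ and $r$ is odd.
   Context: The Stern sequence $(s(n))_{n\ge 0}$ is defined by $s(0)=0$, $s(1)=1$, $s(2n)=s(n)$ and $s(2n+1)=s(n)+s(n+1)$ for all $n\ge 0$. For $r \ge 0$, the $r$th row of Stern's diatomic array is the list $s(2^r), s(2^r+1), \dotsc, s(2^{r+1})$. For $r\ge 0$ and $m\ge 1$, $L_m(r)$ denotes the $m$th largest distinct value occurring in the $r$th row (and $L_m(r)=-\infty$ if the row has fewer than $m$ distinct values). $F_n$ denotes the $n$th Fibonacci number, defined for all $n\in\mathbb{Z}$ by $F_0=0$, $F_1=1$, $F_n=F_{n-1}+F_{n-2}$. -}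

module Defs where

open import Data.Nat using (ℕ; zero; suc; _+_; _*_; _∸_; _^_; _<_; _<?_; _≤ᵇ_)
open import Data.Nat.DivMod using (_/_; _%_)
open import Data.Nat.Properties using (_≟_)
open import Data.Bool using (Bool; true; false; _∨_; if_then_else_)
open import Data.List using (List; map; upTo; filter; length; deduplicate)
open import Data.List.Membership.Propositional using (_∈_)
open import Data.Product using (_×_)
open import Relation.Binary.PropositionalEquality using (_≡_)

-- With fuel (suc n) the recursion
-- never runs out for argument n (each step strictly decreases the argument),
-- so  stern n  satisfies s(0)=0, s(1)=1, s(2n)=s(n), s(2n+1)=s(n)+s(n+1).
sternF : ℕ → ℕ → ℕ
sternF zero _ = 0
sternF (suc f) zero = 0
sternF (suc f) (suc zero) = 1
sternF (suc f) (suc (suc n)) with (suc (suc n)) % 2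
... | zero = sternF f (suc (suc n) / 2)
... | suc _ = sternF f (suc (suc n) / 2) + sternF f (suc (suc n) / 2 + 1)

stern : ℕ → ℕ
stern n = sternF (suc n) n

-- The r-th row of Stern's diatomic array: s(2^r), s(2^r+1), ..., s(2^(r+1)).
row : ℕ → List ℕ
row r = map (λ k → stern (2 ^ r + k)) (upTo (suc (2 ^ r)))

numLarger : ℕ → ℕ → ℕ
numLarger r v = length (deduplicate _≟_ (filter (v <?_) (row r)))

-- IsL r m v  :  v is the m-th largest distinct value occurring in row r,
-- i.e. L_m(r) = v  (for m ≥ 1).  If the row has fewer than m distinct
-- values (L_m(r) = -∞), no v satisfies it.
IsL : ℕ → ℕ → ℕ → Set
IsL r m v = (v ∈ row r) × (suc (numLarger r v) ≡ m)

fib : ℕ → ℕ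
fib zero = 0
fib (suc zero) = 1
fib (suc (suc n)) = fib (suc n) + fib n

ceilHalf : ℕ → ℕ
ceilHalf r = (r + 1) / 2

floorQ : ℕ → ℕ
floorQ r = (r + 3) / 4

bTerm : ℕ → ℕ → ℕ
bTerm r m = if (m ≤ᵇ floorQ r) ∨ (r % 2 ≤ᵇ 0) then 0 else 1

{-# OPTIONS --safe #-}
-- Two consecutive entries a, b of row k of the diatomic array are, in one order or the other,
-- F (k + 1) − x and F (k + 2) − y for some deficits x, y ≥ 0, and their children
-- (a, a + b) and (a + b, b) in row k + 1 carry the deficits (y, x + y) and (F k + x, x + y).
-- Following the deficits down the tree shows that the entries a + b which are new in row k + 1
-- are either F (k + 3) − F i F j with i + j = k, each such value occurring, or at most
-- F (k + 3) − F (k − 1), while the inherited entries are at most F (k + 2).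
-- By the addition formula every such product F i F j is at most F (k − 1), and Vajda's identity
-- F (i + n) F (j + n) − F n F (i + j + n) = (−1)ⁿ F i F j shows that, listed in increasing order,
-- these products are the closed forms of the theorem. So the m-th largest value of the row is
-- F (k + 3) minus the m-th smallest product.
module Submission where

open import Defs
open import Data.Bool using (true; false; T)
open import Data.Bool.Properties using (∨-zeroʳ)
open import Data.Empty using (⊥-elim)
open import Data.Integer using (ℤ; +_; -_; _-_; -1ℤ; 1ℤ)
import Data.Integer as ℤ
import Data.Integer.Properties as ℤ
import Data.Integer.Tactic.RingSolver as ℤ-Solver
open import Data.Nat
open import Data.Nat.Properties
open import Data.Nat.DivMod
open import Data.Nat.Divisibility using (divides)
open import Data.Nat.Tactic.RingSolver
open import Data.List using (List; _∷_; []; length; filter; deduplicate; applyUpTo)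
open import Data.List.Properties using (length-applyUpTo)
open import Data.List.Membership.Propositional using (_∈_)
open import Data.List.Membership.Propositional.Properties
  using (∈-map⁺; ∈-map⁻; ∈-upTo⁺; ∈-upTo⁻; ∈-filter⁺; ∈-filter⁻; ∈-applyUpTo⁺; ∈-applyUpTo⁻;
         ∈-deduplicate⁺; ∈-deduplicate⁻)
open import Data.List.Membership.Propositional.Properties.WithK using (unique∧set⇒bag)
open import Data.List.Relation.Unary.Unique.Propositional using (Unique)
open import Data.List.Relation.Unary.Unique.Propositional.Properties using (applyUpTo⁺₁)
open import Data.List.Relation.Unary.Unique.DecPropositional.Properties _≟_ using (deduplicate-!)
open import Data.List.Relation.Binary.BagAndSetEquality using (∼bag⇒↭)
open import Data.List.Relation.Binary.Permutation.Propositional.Properties using (↭-length)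
open import Data.Product using (∃; ∃-syntax; _×_; _,_; proj₁; proj₂)
import Data.Product as Product
open import Data.Sum using (_⊎_; inj₁; inj₂)
import Data.Sum as Sum
open import Function.Base using (_∘_)
open import Function.Bundles using (mk⇔)
open import Relation.Nullary using (contradiction)
open import Relation.Binary.PropositionalEquality

data ParityView : ℕ → Set where
  even : ∀ q → ParityView (q * 2)
  odd  : ∀ q → ParityView (suc (q * 2))

parityView : ∀ n → ParityView n
parityView zero = even 0
parityView (suc n) with parityView n
... | even q = odd q
... | odd q = even (suc q)

suc-double/2 : ∀ k → suc (k * 2) / 2 ≡ k
suc-double/2 k = trans (+-distrib-/-∣ʳ 1 {d = 2} (divides k refl)) (m*n/n≡m k 2)

-- Fibonacci identities

private
  F : ℕ → ℤ
  F n = + fib n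

cassini : ∀ n → F (suc n) ℤ.* F (suc n) - F n ℤ.* F (suc (suc n)) ≡ -1ℤ ℤ.^ n
cassini zero = refl
cassini (suc n) = trans (flip (F n) (F (suc n))) (cong (-1ℤ ℤ.*_) (cassini n))
  where
  flip : ∀ a b → (b ℤ.+ a) ℤ.* (b ℤ.+ a) - b ℤ.* ((b ℤ.+ a) ℤ.+ b)
               ≡ -1ℤ ℤ.* (b ℤ.* b - a ℤ.* (b ℤ.+ a))
  flip = ℤ-Solver.solve-∀

vajda-ℤ : ∀ n i j → F (i + n) ℤ.* F (j + n) - F n ℤ.* F (i + (j + n))
                     ≡ -1ℤ ℤ.^ n ℤ.* (F i ℤ.* F j)
vajda-ℤ n zero j = cancel (F n) (F (j + n)) (-1ℤ ℤ.^ n) (F j)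
  where
  cancel : ∀ a b s g → a ℤ.* b - a ℤ.* b ≡ s ℤ.* (+ 0 ℤ.* g)
  cancel = ℤ-Solver.solve-∀
vajda-ℤ n (suc zero) j = d'Ocagne j
  where
  d'Ocagne : ∀ j → F (suc n) ℤ.* F (j + n) - F n ℤ.* F (suc (j + n))
                   ≡ -1ℤ ℤ.^ n ℤ.* (+ 1 ℤ.* F j)
  d'Ocagne zero = swap (F n) (F (suc n)) (-1ℤ ℤ.^ n)
    where
    swap : ∀ a b s → b ℤ.* a - a ℤ.* b ≡ s ℤ.* (+ 1 ℤ.* + 0)
    swap = ℤ-Solver.solve-∀
  d'Ocagne (suc zero) = trans (cassini n) (unit (-1ℤ ℤ.^ n))
    where
    unit : ∀ s → s ≡ s ℤ.* (+ 1 ℤ.* + 1)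
    unit = ℤ-Solver.solve-∀
  d'Ocagne (suc (suc j)) =
    trans (split (F (suc n)) (F n) (F (suc (j + n))) (F (j + n)) (F (suc (suc (j + n)))) (F (suc (j + n))))
      (trans (cong₂ ℤ._+_ (d'Ocagne (suc j)) (d'Ocagne j)) (collect (-1ℤ ℤ.^ n) (F (suc j)) (F j)))
    where
    split : ∀ a b x₁ x₀ y₁ y₀ → a ℤ.* (x₁ ℤ.+ x₀) - b ℤ.* (y₁ ℤ.+ y₀)
                                 ≡ (a ℤ.* x₁ - b ℤ.* y₁) ℤ.+ (a ℤ.* x₀ - b ℤ.* y₀)
    split = ℤ-Solver.solve-∀
    collect : ∀ s g₁ g₀ → s ℤ.* (+ 1 ℤ.* g₁) ℤ.+ s ℤ.* (+ 1 ℤ.* g₀)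
                          ≡ s ℤ.* (+ 1 ℤ.* (g₁ ℤ.+ g₀))
    collect = ℤ-Solver.solve-∀
vajda-ℤ n (suc (suc i)) j =
  trans (split (F (suc (i + n))) (F (i + n)) (F (j + n)) (F n) (F (suc (i + (j + n)))) (F (i + (j + n))))
    (trans (cong₂ ℤ._+_ (vajda-ℤ n (suc i) j) (vajda-ℤ n i j))
           (collect (-1ℤ ℤ.^ n) (F (suc i)) (F i) (F j)))
  where
  split : ∀ a₁ a₀ b c d₁ d₀ → (a₁ ℤ.+ a₀) ℤ.* b - c ℤ.* (d₁ ℤ.+ d₀)
                               ≡ (a₁ ℤ.* b - c ℤ.* d₁) ℤ.+ (a₀ ℤ.* b - c ℤ.* d₀)
  split = ℤ-Solver.solve-∀
  collect : ∀ s f₁ f₀ g → s ℤ.* (f₁ ℤ.* g) ℤ.+ s ℤ.* (f₀ ℤ.* g)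
                          ≡ s ℤ.* ((f₁ ℤ.+ f₀) ℤ.* g)
  collect = ℤ-Solver.solve-∀

private
  F-product : ∀ a b → F a ℤ.* F b ≡ + (fib a * fib b)
  F-product a b = sym (ℤ.pos-* (fib a) (fib b))

  vajda-difference : ∀ n i j → + (fib (i + n) * fib (j + n)) - + (fib n * fib (i + (j + n)))
                               ≡ -1ℤ ℤ.^ n ℤ.* + (fib i * fib j)
  vajda-difference n i j = begin
    + (fib (i + n) * fib (j + n)) - + (fib n * fib (i + (j + n)))
      ≡⟨ sym (cong₂ _-_ (F-product (i + n) (j + n)) (F-product n (i + (j + n)))) ⟩
    F (i + n) ℤ.* F (j + n) - F n ℤ.* F (i + (j + n))
      ≡⟨ vajda-ℤ n i j ⟩
    -1ℤ ℤ.^ n ℤ.* (F i ℤ.* F j)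
      ≡⟨ cong (-1ℤ ℤ.^ n ℤ.*_) (F-product i j) ⟩
    -1ℤ ℤ.^ n ℤ.* + (fib i * fib j) ∎
    where open ≡-Reasoning

  -1^even : ∀ h → -1ℤ ℤ.^ (h * 2) ≡ 1ℤ
  -1^even zero = refl
  -1^even (suc h) = cong (λ s → -1ℤ ℤ.* (-1ℤ ℤ.* s)) (-1^even h)

  -1^odd : ∀ h → -1ℤ ℤ.^ suc (h * 2) ≡ -1ℤ
  -1^odd h = cong (-1ℤ ℤ.*_) (-1^even h)

  i≡[i-j]+j : ∀ (i j : ℤ) → i ≡ (i - j) ℤ.+ j
  i≡[i-j]+j = ℤ-Solver.solve-∀

  j≡i-[i-j] : ∀ (i j : ℤ) → j ≡ i - (i - j)
  j≡i-[i-j] = ℤ-Solver.solve-∀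

vajda-even : ∀ h i j → fib (i + h * 2) * fib (j + h * 2)
                       ≡ fib (h * 2) * fib (i + (j + h * 2)) + fib i * fib j
vajda-even h i j = ℤ.+-injective (begin
  + A                  ≡⟨ i≡[i-j]+j (+ A) (+ B) ⟩
  (+ A - + B) ℤ.+ + B  ≡⟨ cong (ℤ._+ + B) (vajda-difference (h * 2) i j) ⟩
  -1ℤ ℤ.^ (h * 2) ℤ.* + C ℤ.+ + B ≡⟨ cong (λ s → s ℤ.* + C ℤ.+ + B) (-1^even h) ⟩
  1ℤ ℤ.* + C ℤ.+ + B   ≡⟨ cong (ℤ._+ + B) (ℤ.*-identityˡ (+ C)) ⟩
  + (C + B)            ≡⟨ cong +_ (+-comm C B) ⟩
  + (B + C)            ∎)
  where
  open ≡-Reasoning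
  A : ℕ
  A = fib (i + h * 2) * fib (j + h * 2)
  B : ℕ
  B = fib (h * 2) * fib (i + (j + h * 2))
  C : ℕ
  C = fib i * fib j

vajda-odd : ∀ h i j → fib (suc (h * 2)) * fib (i + (j + suc (h * 2)))
                      ≡ fib (i + suc (h * 2)) * fib (j + suc (h * 2)) + fib i * fib j
vajda-odd h i j = ℤ.+-injective (begin
  + B                       ≡⟨ j≡i-[i-j] (+ A) (+ B) ⟩
  + A - (+ A - + B)         ≡⟨ cong (_-_ (+ A)) (vajda-difference n i j) ⟩
  + A - (-1ℤ ℤ.^ n ℤ.* + C) ≡⟨ cong (λ s → + A - s ℤ.* + C) (-1^odd h) ⟩
  + A - (-1ℤ ℤ.* + C)       ≡⟨ cong (_-_ (+ A)) (ℤ.-1*i≡-i (+ C)) ⟩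
  + A - - + C               ≡⟨ cong (λ d → + A ℤ.+ d) (ℤ.neg-involutive (+ C)) ⟩
  + (A + C)                 ∎)
  where
  open ≡-Reasoning
  n : ℕ
  n = suc (h * 2)
  A : ℕ
  A = fib (i + n) * fib (j + n)
  B : ℕ
  B = fib n * fib (i + (j + n))
  C : ℕ
  C = fib i * fib j

fib-pos : ∀ n → 0 < fib (suc n)
fib-pos zero = s≤s z≤n
fib-pos (suc n) = ≤-trans (fib-pos n) (m≤m+n _ _)

fib-≤-suc : ∀ n → fib n ≤ fib (suc n)
fib-≤-suc zero = z≤n
fib-≤-suc (suc n) = m≤m+n _ _

fib-product-pos : ∀ i j → 0 < fib (suc i) * fib (suc j)
fib-product-pos i j = *-mono-≤ (fib-pos i) (fib-pos j)

fib-add : ∀ i j → fib (suc (i + j)) ≡ fib (suc i) * fib (suc j) + fib i * fib j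
fib-add zero j = sym (trans (+-identityʳ _) (+-identityʳ _))
fib-add (suc zero) j = cong₂ _+_ (sym (+-identityʳ (fib (suc j)))) (sym (+-identityʳ (fib j)))
fib-add (suc (suc i)) j = begin
  fib (suc (suc (suc (i + j))))
    ≡⟨ cong₂ _+_ (fib-add (suc i) j) (fib-add i j) ⟩
  (fib (suc (suc i)) * fib (suc j) + fib (suc i) * fib j) + (fib (suc i) * fib (suc j) + fib i * fib j)
    ≡⟨ regroup (fib (suc (suc i))) (fib (suc i)) (fib i) (fib (suc j)) (fib j) ⟩
  (fib (suc (suc i)) + fib (suc i)) * fib (suc j) + (fib (suc i) + fib i) * fib j ∎
  where
  open ≡-Reasoning
  regroup : ∀ a₂ a₁ a₀ b₁ b₀ → (a₂ * b₁ + a₁ * b₀) + (a₁ * b₁ + a₀ * b₀)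
                               ≡ (a₂ + a₁) * b₁ + (a₁ + a₀) * b₀
  regroup = solve-∀

fib-product-≤ : ∀ i j → fib i * fib j ≤ fib (i + j ∸ 1)
fib-product-≤ zero j = z≤n
fib-product-≤ (suc i) zero = subst (_≤ fib (i + 0)) (sym (*-zeroʳ (fib (suc i)))) z≤n
fib-product-≤ (suc i) (suc j) = begin
  fib (suc i) * fib (suc j)                  ≤⟨ m≤m+n _ _ ⟩
  fib (suc i) * fib (suc j) + fib i * fib j  ≡⟨ fib-add i j ⟨
  fib (suc (i + j))                          ≡⟨ cong fib (+-suc i j) ⟨
  fib (i + suc j)                            ∎
  where open ≤-Reasoning

fib-≤-double-product : ∀ i j → fib (suc (i + j)) ≤ 2 * (fib (suc i) * fib (suc j))
fib-≤-double-product i j = begin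
  fib (suc (i + j))  ≡⟨ fib-add i j ⟩
  P + fib i * fib j  ≤⟨ +-monoʳ-≤ P (*-mono-≤ (fib-≤-suc i) (fib-≤-suc j)) ⟩
  P + P              ≡⟨ cong (_+_ P) (+-identityʳ P) ⟨
  2 * P              ∎
  where
  open ≤-Reasoning
  P : ℕ
  P = fib (suc i) * fib (suc j)

fib-even-shift : ∀ h i j → fib (h * 2) * fib (suc i + (suc j + h * 2))
                           < fib (suc i + h * 2) * fib (suc j + h * 2)
fib-even-shift h i j =
  <-≤-trans (m<m+n _ (fib-product-pos i j)) (≤-reflexive (sym (vajda-even h (suc i) (suc j))))

fib-odd-shift : ∀ h i j → fib (suc i + suc (h * 2)) * fib (suc j + suc (h * 2))
                          < fib (suc (h * 2)) * fib (suc i + (suc j + suc (h * 2)))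
fib-odd-shift h i j =
  <-≤-trans (m<m+n _ (fib-product-pos i j)) (≤-reflexive (sym (vajda-odd h (suc i) (suc j))))

-- The products F i F j with i + j = r − 1 in increasing order

ceilHalf-even : ∀ q → ceilHalf (q * 2) ≡ q
ceilHalf-even q = trans (cong (_/ 2) (+-comm (q * 2) 1)) (suc-double/2 q)

ceilHalf-odd : ∀ q → ceilHalf (suc (q * 2)) ≡ suc q
ceilHalf-odd q = trans (cong (_/ 2) (+-comm (suc (q * 2)) 1)) (m*n/n≡m (suc q) 2)

floorQ-odd-≥ : ∀ q h → h * 2 ≤ q → suc h ≤ floorQ (suc (q * 2))
floorQ-odd-≥ q h h*2≤q = begin
  suc h                    ≡⟨ m*n/n≡m (suc h) 4 ⟨
  suc h * 4 / 4            ≤⟨ /-monoˡ-≤ 4 bound ⟩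
  (suc (q * 2) + 3) / 4    ∎
  where
  open ≤-Reasoning
  bound : suc h * 4 ≤ suc (q * 2) + 3
  bound = begin
    suc h * 4       ≡⟨ solve (h ∷ []) ⟩
    4 + h * 2 * 2   ≤⟨ +-monoʳ-≤ 4 (*-monoˡ-≤ 2 h*2≤q) ⟩
    4 + q * 2       ≡⟨ solve (q ∷ []) ⟩
    suc (q * 2) + 3 ∎

floorQ-odd-< : ∀ q h → q < h * 2 → floorQ (suc (q * 2)) < suc h
floorQ-odd-< q h q<h*2 = m<n*o⇒m/o<n (begin
  suc (suc (q * 2) + 3)  ≡⟨ solve (q ∷ []) ⟩
  3 + suc q * 2          ≤⟨ +-monoʳ-≤ 3 (*-monoˡ-≤ 2 q<h*2) ⟩
  3 + h * 2 * 2          ≤⟨ n≤1+n _ ⟩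
  4 + h * 2 * 2          ≡⟨ solve (h ∷ []) ⟩
  suc h * 4              ∎)
  where open ≤-Reasoning

bTerm-even : ∀ q m → bTerm (q * 2) m ≡ 0
bTerm-even q m rewrite m*n%n≡0 q 2 ⦃ _ ⦄ | ∨-zeroʳ (m ≤ᵇ floorQ (q * 2)) = refl

bTerm-low : ∀ r m → m ≤ floorQ r → bTerm r m ≡ 0
bTerm-low r m m≤ with m ≤ᵇ floorQ r | ≤⇒≤ᵇ m≤
... | true | _ = refl

bTerm-odd-high : ∀ q h → q < h * 2 → bTerm (suc (q * 2)) (suc h) ≡ 1
bTerm-odd-high q h q<h*2 with suc h ≤ᵇ floorQ (suc (q * 2)) in low
... | true  = contradiction (≤ᵇ⇒≤ _ _ (subst T (sym low) _)) (<⇒≱ (floorQ-odd-< q h q<h*2))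
... | false rewrite [m+kn]%n≡m%n 1 q 2 ⦃ _ ⦄ = refl

-- The paper's L_m(r) is F (r + 2) − sortedProduct r m.
sortedProduct : ℕ → ℕ → ℕ
sortedProduct r m = fib (2 * m ∸ 2 ∸ bTerm r m) * fib (r + 1 + bTerm r m ∸ 2 * m)

private
  ∸-from-+ : ∀ {a} b c → a ≡ b + c → a ∸ b ≡ c
  ∸-from-+ b c a≡b+c = trans (cong (_∸ b) a≡b+c) (m+n∸m≡n b c)

sortedProduct-b₀ : ∀ r h j → bTerm r (suc h) ≡ 0 → suc (h * 2 + j) ≡ r →
                   sortedProduct r (suc h) ≡ fib (h * 2) * fib j
sortedProduct-b₀ r h j b≡0 refl rewrite b≡0 =
  cong₂ (λ a b → fib a * fib b) (cong (_∸ 2) twice) (∸-from-+ (2 * suc h) j total)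
  where
  twice : 2 * suc h ≡ 2 + h * 2
  twice = solve (h ∷ [])
  total : suc (h * 2 + j) + 1 + 0 ≡ 2 * suc h + j
  total = solve (h ∷ j ∷ [])

sortedProduct-b₁ : ∀ r g j → bTerm r (suc (suc g)) ≡ 1 → suc (suc (g * 2) + j) ≡ r →
                   sortedProduct r (suc (suc g)) ≡ fib (suc (g * 2)) * fib j
sortedProduct-b₁ r g j b≡1 refl rewrite b≡1 =
  cong₂ (λ a b → fib a * fib b) (cong (λ n → n ∸ 2 ∸ 1) twice) (∸-from-+ (2 * suc (suc g)) j total)
  where
  twice : 2 * suc (suc g) ≡ 2 + suc (suc (g * 2))
  twice = solve (g ∷ [])
  total : suc (suc (g * 2) + j) + 1 + 1 ≡ 2 * suc (suc g) + j
  total = solve (g ∷ j ∷ [])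

sortedProduct-even : ∀ q h j → suc (h * 2 + j) ≡ q * 2 →
                     sortedProduct (q * 2) (suc h) ≡ fib (h * 2) * fib j
sortedProduct-even q h j = sortedProduct-b₀ (q * 2) h j (bTerm-even q (suc h))

sortedProduct-odd-low : ∀ q h j → h * 2 ≤ q → suc (h * 2 + j) ≡ suc (q * 2) →
                        sortedProduct (suc (q * 2)) (suc h) ≡ fib (h * 2) * fib j
sortedProduct-odd-low q h j h*2≤q =
  sortedProduct-b₀ (suc (q * 2)) h j (bTerm-low (suc (q * 2)) (suc h) (floorQ-odd-≥ q h h*2≤q))

sortedProduct-odd-high : ∀ q g j → q < suc g * 2 → suc (suc (g * 2) + j) ≡ suc (q * 2) →
                         sortedProduct (suc (q * 2)) (suc (suc g)) ≡ fib (suc (g * 2)) * fib j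
sortedProduct-odd-high q g j q<sg*2 =
  sortedProduct-b₁ (suc (q * 2)) g j (bTerm-odd-high q (suc g) q<sg*2)

private
  even-row-step-≤ : ∀ q h d → suc (suc h) + (h + d) ≡ q →
                    sortedProduct (q * 2) (suc h) < sortedProduct (q * 2) (suc (suc h))
  even-row-step-≤ q h d refl = begin-strict
    sortedProduct (q * 2) (suc h)                 ≡⟨ sortedProduct-even q h _ sum₁ ⟩
    fib (h * 2) * fib (2 + (suc (d * 2) + h * 2)) <⟨ fib-even-shift h 1 (d * 2) ⟩
    fib (2 + h * 2) * fib (suc (d * 2) + h * 2)   ≡⟨ sortedProduct-even q (suc h) _ sum₂ ⟨
    sortedProduct (q * 2) (suc (suc h))           ∎
    where
    open ≤-Reasoning
    sum₁ : suc (h * 2 + (2 + (suc (d * 2) + h * 2))) ≡ q * 2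
    sum₁ = solve (h ∷ d ∷ [])
    sum₂ : suc (suc h * 2 + (suc (d * 2) + h * 2)) ≡ q * 2
    sum₂ = solve (h ∷ d ∷ [])

  even-row-step-> : ∀ q e d → suc (suc (suc e + d)) + e ≡ q →
                    sortedProduct (q * 2) (suc (suc e + d)) < sortedProduct (q * 2) (suc (suc (suc e + d)))
  even-row-step-> q e d refl = begin-strict
    sortedProduct (q * 2) (suc h)        ≡⟨ sortedProduct-even q h _ sum₁ ⟩
    fib (h * 2) * fib (2 + n)            ≡⟨ cong (λ k → fib k * fib (2 + n)) split ⟩
    fib (suc (d * 2) + n) * fib (2 + n)  ≡⟨ *-comm _ (fib (2 + n)) ⟩
    fib (2 + n) * fib (suc (d * 2) + n)  <⟨ fib-odd-shift e 1 (d * 2) ⟩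
    fib n * fib (2 + (suc (d * 2) + n))  ≡⟨ cong (λ k → fib n * fib (2 + k)) split ⟨
    fib n * fib (suc h * 2)              ≡⟨ *-comm (fib n) _ ⟩
    fib (suc h * 2) * fib n              ≡⟨ sortedProduct-even q (suc h) n sum₂ ⟨
    sortedProduct (q * 2) (suc (suc h))  ∎
    where
    open ≤-Reasoning
    h : ℕ
    h = suc e + d
    n : ℕ
    n = suc (e * 2)
    split : (suc e + d) * 2 ≡ suc (d * 2) + suc (e * 2)
    split = solve (e ∷ d ∷ [])
    sum₁ : suc ((suc e + d) * 2 + (2 + suc (e * 2))) ≡ q * 2
    sum₁ = solve (e ∷ d ∷ [])
    sum₂ : suc (suc (suc e + d) * 2 + suc (e * 2)) ≡ q * 2
    sum₂ = solve (e ∷ d ∷ [])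

sortedProduct-even-step : ∀ q h → suc (suc h) ≤ q →
                          sortedProduct (q * 2) (suc h) < sortedProduct (q * 2) (suc (suc h))
sortedProduct-even-step q h ssh≤q with m≤n⇒∃[o]m+o≡n ssh≤q
... | e , q≡ with ≤-<-connex h e
...   | inj₁ h≤e with m≤n⇒∃[o]m+o≡n h≤e
...     | d , refl = even-row-step-≤ q h d q≡
sortedProduct-even-step q h ssh≤q | e , q≡ | inj₂ e<h with m≤n⇒∃[o]m+o≡n e<h
... | d , refl = even-row-step-> q e d q≡

private
  odd-row-step-low : ∀ q h d → suc h * 2 + d ≡ q →
                     sortedProduct (suc (q * 2)) (suc h) < sortedProduct (suc (q * 2)) (suc (suc h))
  odd-row-step-low q h d refl = begin-strict
    sortedProduct (suc (q * 2)) (suc h)                 ≡⟨ sortedProduct-odd-low q h _ h*2≤q sum₁ ⟩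
    fib (h * 2) * fib (2 + (suc (suc (d * 2)) + h * 2)) <⟨ fib-even-shift h 1 (suc (d * 2)) ⟩
    fib (2 + h * 2) * fib (suc (suc (d * 2)) + h * 2)   ≡⟨ sortedProduct-odd-low q (suc h) _ sh*2≤q sum₂ ⟨
    sortedProduct (suc (q * 2)) (suc (suc h))           ∎
    where
    open ≤-Reasoning
    sh*2≤q : suc h * 2 ≤ q
    sh*2≤q = m≤m+n (suc h * 2) d
    h*2≤q : h * 2 ≤ q
    h*2≤q = ≤-trans (n≤1+n _) (<⇒≤ sh*2≤q)
    sum₁ : suc (h * 2 + (2 + (suc (suc (d * 2)) + h * 2))) ≡ suc (q * 2)
    sum₁ = solve (h ∷ d ∷ [])
    sum₂ : suc (suc h * 2 + (suc (suc (d * 2)) + h * 2)) ≡ suc (q * 2)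
    sum₂ = solve (h ∷ d ∷ [])

  odd-row-step-jump : ∀ q h → h * 2 ≤ q → q < suc h * 2 → suc h ≤ q →
                      sortedProduct (suc (q * 2)) (suc h) < sortedProduct (suc (q * 2)) (suc (suc h))
  odd-row-step-jump q h h*2≤q q<sh*2 sh≤q with m≤n⇒∃[o]m+o≡n h*2≤q
  odd-row-step-jump q zero _ _ () | 0 , refl
  odd-row-step-jump q (suc g) h*2≤q q<sh*2 _ | 0 , refl = begin-strict
    sortedProduct (suc (q * 2)) (suc (suc g))       ≡⟨ sortedProduct-odd-low q (suc g) _ h*2≤q sum₁ ⟩
    fib (1 + n) * fib (1 + n)                       <⟨ fib-odd-shift g 0 0 ⟩
    fib n * fib (suc (suc g * 2))                   ≡⟨ *-comm (fib n) _ ⟩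
    fib (suc (suc g * 2)) * fib n                   ≡⟨ sortedProduct-odd-high q (suc g) n q<sh*2 sum₂ ⟨
    sortedProduct (suc (q * 2)) (suc (suc (suc g))) ∎
    where
    open ≤-Reasoning
    n : ℕ
    n = suc (g * 2)
    sum₁ : suc (suc g * 2 + suc g * 2) ≡ suc ((suc g * 2 + 0) * 2)
    sum₁ = solve (g ∷ [])
    sum₂ : suc (suc (suc g * 2) + suc (g * 2)) ≡ suc ((suc g * 2 + 0) * 2)
    sum₂ = solve (g ∷ [])
  odd-row-step-jump q h h*2≤q q<sh*2 _ | 1 , refl = begin-strict
    sortedProduct (suc (q * 2)) (suc h)        ≡⟨ sortedProduct-odd-low q h _ h*2≤q sum₁ ⟩
    fib (h * 2) * fib (1 + (1 + h * 2))        <⟨ fib-even-shift h 0 0 ⟩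
    fib (1 + h * 2) * fib (1 + h * 2)          ≡⟨ sortedProduct-odd-high q h _ q<sh*2 sum₂ ⟨
    sortedProduct (suc (q * 2)) (suc (suc h))  ∎
    where
    open ≤-Reasoning
    sum₁ : suc (h * 2 + (1 + (1 + h * 2))) ≡ suc ((h * 2 + 1) * 2)
    sum₁ = solve (h ∷ [])
    sum₂ : suc (suc (h * 2) + (1 + h * 2)) ≡ suc ((h * 2 + 1) * 2)
    sum₂ = solve (h ∷ [])
  odd-row-step-jump q h _ q<sh*2 _ | suc (suc d) , refl
    with +-cancelˡ-≤ (h * 2) (suc (suc d)) 1 (≤-trans (s≤s⁻¹ q<sh*2) (≤-reflexive (+-comm 1 (h * 2))))
  ... | s≤s ()

  odd-row-step-high : ∀ q c d → suc (suc (suc c + d)) + c ≡ q →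
                      sortedProduct (suc (q * 2)) (suc (suc (suc c + d)))
                      < sortedProduct (suc (q * 2)) (suc (suc (suc (suc c + d))))
  odd-row-step-high q c d refl = begin-strict
    sortedProduct (suc (q * 2)) (suc (suc g))       ≡⟨ sortedProduct-odd-high q g _ q<sg*2 sum₁ ⟩
    fib (suc (g * 2)) * fib (2 + n)                 ≡⟨ cong (λ k → fib k * fib (2 + n)) split ⟩
    fib (suc (suc (d * 2)) + n) * fib (2 + n)       ≡⟨ *-comm _ (fib (2 + n)) ⟩
    fib (2 + n) * fib (suc (suc (d * 2)) + n)       <⟨ fib-odd-shift c 1 (suc (d * 2)) ⟩
    fib n * fib (2 + (suc (suc (d * 2)) + n))       ≡⟨ cong (λ k → fib n * fib (2 + k)) split ⟨
    fib n * fib (suc (suc g * 2))                   ≡⟨ *-comm (fib n) _ ⟩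
    fib (suc (suc g * 2)) * fib n                   ≡⟨ sortedProduct-odd-high q (suc g) n q<ssg*2 sum₂ ⟨
    sortedProduct (suc (q * 2)) (suc (suc (suc g))) ∎
    where
    open ≤-Reasoning
    g : ℕ
    g = suc c + d
    n : ℕ
    n = suc (c * 2)
    slack : suc q + d ≡ suc (suc c + d) * 2
    slack = solve (c ∷ d ∷ [])
    q<sg*2 : q < suc g * 2
    q<sg*2 = ≤-trans (m≤m+n (suc q) d) (≤-reflexive slack)
    q<ssg*2 : q < suc (suc g) * 2
    q<ssg*2 = ≤-trans q<sg*2 (≤-trans (n≤1+n _) (n≤1+n _))
    split : suc ((suc c + d) * 2) ≡ suc (suc (d * 2)) + suc (c * 2)
    split = solve (c ∷ d ∷ [])
    sum₁ : suc (suc ((suc c + d) * 2) + (2 + suc (c * 2))) ≡ suc (q * 2)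
    sum₁ = solve (c ∷ d ∷ [])
    sum₂ : suc (suc (suc (suc c + d) * 2) + suc (c * 2)) ≡ suc (q * 2)
    sum₂ = solve (c ∷ d ∷ [])

sortedProduct-odd-step : ∀ q h → suc h ≤ q →
                         sortedProduct (suc (q * 2)) (suc h) < sortedProduct (suc (q * 2)) (suc (suc h))
sortedProduct-odd-step q h sh≤q with ≤-<-connex (suc h * 2) q
... | inj₁ sh*2≤q with m≤n⇒∃[o]m+o≡n sh*2≤q
...   | d , q≡ = odd-row-step-low q h d q≡
sortedProduct-odd-step q h sh≤q | inj₂ q<sh*2 with ≤-<-connex (h * 2) q
... | inj₁ h*2≤q = odd-row-step-jump q h h*2≤q q<sh*2 sh≤q
sortedProduct-odd-step q zero _ | inj₂ _ | inj₂ ()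
sortedProduct-odd-step q (suc g) ssg≤q | inj₂ _ | inj₂ q<sg*2 with m≤n⇒∃[o]m+o≡n ssg≤q
... | c , refl with m≤n⇒∃[o]m+o≡n c<g
  where
  c<g : c < g
  c<g = +-cancelˡ-≤ g (suc c) g (begin
    g + suc c  ≡⟨ +-suc g c ⟩
    suc g + c  ≤⟨ s≤s⁻¹ (s≤s⁻¹ q<sg*2) ⟩
    g * 2      ≡⟨ solve (g ∷ []) ⟩
    g + g      ∎)
    where open ≤-Reasoning
...   | d , refl = odd-row-step-high _ c d refl

private
  double≢suc-double : ∀ m n → m * 2 ≢ suc (n * 2)
  double≢suc-double m n e = even≢odd m n (trans (*-comm 2 m) (trans e (cong suc (*-comm n 2))))

  double-suc-≤ : ∀ {h q} → suc h ≤ q → suc (h * 2) ≤ q * 2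
  double-suc-≤ sh≤q = <⇒≤ (*-monoˡ-≤ 2 sh≤q)

  half-bound : ∀ a b q → suc (a * 2 + suc (b * 2)) ≡ q * 2 → suc a ≤ q
  half-bound a b q e = *-cancelʳ-≤ (suc a) q 2 (begin
    suc (suc (a * 2))          ≤⟨ s≤s (m<m+n (a * 2) z<s) ⟩
    suc (a * 2 + suc (b * 2))  ≡⟨ e ⟩
    q * 2                      ∎)
    where open ≤-Reasoning

sortedProduct-product : ∀ r h → suc h ≤ ceilHalf r →
                        ∃[ i ] ∃[ j ] (suc (i + j) ≡ r × sortedProduct r (suc h) ≡ fib i * fib j)
sortedProduct-product r h sh≤⌈r/2⌉ with parityView r
... | even q with m≤n⇒∃[o]m+o≡n (double-suc-≤ (subst (suc h ≤_) (ceilHalf-even q) sh≤⌈r/2⌉))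
...   | j , e = h * 2 , j , e , sortedProduct-even q h j e
sortedProduct-product r h sh≤⌈r/2⌉ | odd q with ≤-<-connex (h * 2) q
... | inj₁ h*2≤q with m≤n⇒∃[o]m+o≡n (≤-trans h*2≤q (m≤m*n q 2))
...   | j , e = h * 2 , j , cong suc e , sortedProduct-odd-low q h j h*2≤q (cong suc e)
sortedProduct-product r zero sh≤⌈r/2⌉ | odd q | inj₂ ()
sortedProduct-product r (suc g) ssg≤⌈r/2⌉ | odd q | inj₂ q<h*2
  with m≤n⇒∃[o]m+o≡n (double-suc-≤ (s≤s⁻¹ (subst (suc (suc g) ≤_) (ceilHalf-odd q) ssg≤⌈r/2⌉)))
... | j , e = suc (g * 2) , j , cong suc e , sortedProduct-odd-high q g j q<h*2 (cong suc e)

private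
  Ranked : ℕ → ℕ → ℕ → Set
  Ranked r i j = ∃[ h ] (suc h ≤ ceilHalf r × fib i * fib j ≡ sortedProduct r (suc h))

  ranked-swap : ∀ r i j → Ranked r j i → Ranked r i j
  ranked-swap r i j (h , bound , e) = h , bound , trans (*-comm (fib i) (fib j)) e

  ranked-even-row : ∀ q a b → suc (a * 2 + suc (b * 2)) ≡ q * 2 →
                    Ranked (q * 2) (a * 2) (suc (b * 2))
  ranked-even-row q a b e =
    a , subst (suc a ≤_) (sym (ceilHalf-even q)) (half-bound a b q e) , sym (sortedProduct-even q a _ e)

  ranked-odd-row-low : ∀ q a j → a * 2 ≤ q → suc (a * 2 + j) ≡ suc (q * 2) →
                       Ranked (suc (q * 2)) (a * 2) j
  ranked-odd-row-low q a j a*2≤q e =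
    a , subst (suc a ≤_) (sym (ceilHalf-odd q)) (s≤s (≤-trans (m≤m*n a 2) a*2≤q)) ,
    sym (sortedProduct-odd-low q a j a*2≤q e)

  ranked-odd-row-high : ∀ q a b → q < suc a * 2 → suc (suc (a * 2) + suc (b * 2)) ≡ suc (q * 2) →
                        Ranked (suc (q * 2)) (suc (a * 2)) (suc (b * 2))
  ranked-odd-row-high q a b q<sa*2 e =
    suc a , subst (suc (suc a) ≤_) (sym (ceilHalf-odd q)) (s≤s (half-bound a b q (suc-injective e))) ,
    sym (sortedProduct-odd-high q a _ q<sa*2 e)

  ranked-odd-row-evens : ∀ q a b → suc (a * 2 + b * 2) ≡ suc (q * 2) → Ranked (suc (q * 2)) (a * 2) (b * 2)
  ranked-odd-row-evens q a b e with ≤-<-connex (a * 2) q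
  ... | inj₁ a*2≤q = ranked-odd-row-low q a _ a*2≤q e
  ... | inj₂ q<a*2 = ranked-swap (suc (q * 2)) (a * 2) (b * 2)
    (ranked-odd-row-low q b _ (<⇒≤ b*2<q) (trans (cong suc (+-comm (b * 2) (a * 2))) e))
    where
    b*2<q : b * 2 < q
    b*2<q = +-cancelʳ-< q (b * 2) q (begin-strict
      b * 2 + q      <⟨ +-monoʳ-< (b * 2) q<a*2 ⟩
      b * 2 + a * 2  ≡⟨ +-comm (b * 2) (a * 2) ⟩
      a * 2 + b * 2  ≡⟨ suc-injective e ⟩
      q * 2          ≡⟨ solve (q ∷ []) ⟩
      q + q          ∎)
      where open ≤-Reasoning

  ranked-odd-row-odds : ∀ q a b → suc (suc (a * 2) + suc (b * 2)) ≡ suc (q * 2) →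
                        Ranked (suc (q * 2)) (suc (a * 2)) (suc (b * 2))
  ranked-odd-row-odds q a b e with ≤-<-connex (suc a * 2) q
  ... | inj₂ q<sa*2 = ranked-odd-row-high q a b q<sa*2 e
  ... | inj₁ sa*2≤q = ranked-swap (suc (q * 2)) (suc (a * 2)) (suc (b * 2))
    (ranked-odd-row-high q b a q<sb*2 (trans (cong suc (+-comm (suc (b * 2)) (suc (a * 2)))) e))
    where
    regroup : suc a * 2 + suc b * 2 ≡ suc (suc (suc (a * 2) + suc (b * 2)))
    regroup = solve (a ∷ b ∷ [])
    q<sb*2 : q < suc b * 2
    q<sb*2 = +-cancelˡ-≤ q (suc q) (suc b * 2) (begin
      q + suc q              ≤⟨ n≤1+n _ ⟩
      suc (q + suc q)        ≡⟨ solve (q ∷ []) ⟩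
      suc (suc (q * 2))      ≡⟨ trans regroup (cong suc e) ⟨
      suc a * 2 + suc b * 2  ≤⟨ +-monoˡ-≤ (suc b * 2) sa*2≤q ⟩
      q + suc b * 2          ∎)
      where open ≤-Reasoning

product-sortedProduct : ∀ r i j → suc (i + j) ≡ r →
                        ∃[ h ] (suc h ≤ ceilHalf r × fib i * fib j ≡ sortedProduct r (suc h))
product-sortedProduct r i j e with parityView r | parityView i | parityView j
... | even q | even a | odd b = ranked-even-row q a b e
... | even q | odd a | even b =
  ranked-swap (q * 2) (suc (a * 2)) (b * 2) (ranked-even-row q b a (trans (cong suc (+-comm (b * 2) (suc (a * 2)))) e))
... | odd q | even a | even b = ranked-odd-row-evens q a b e
... | odd q | odd a | odd b = ranked-odd-row-odds q a b e
... | even q | even a | even b = ⊥-elim (double≢suc-double q (a + b) (trans (sym e) sum))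
  where
  sum : suc (a * 2 + b * 2) ≡ suc ((a + b) * 2)
  sum = solve (a ∷ b ∷ [])
... | even q | odd a | odd b = ⊥-elim (double≢suc-double q (suc (a + b)) (trans (sym e) sum))
  where
  sum : suc (suc (a * 2) + suc (b * 2)) ≡ suc (suc (a + b) * 2)
  sum = solve (a ∷ b ∷ [])
... | odd q | even a | odd b = ⊥-elim (double≢suc-double q (a + b) (trans (sym (suc-injective e)) sum))
  where
  sum : a * 2 + suc (b * 2) ≡ suc ((a + b) * 2)
  sum = solve (a ∷ b ∷ [])
... | odd q | odd a | even b = ⊥-elim (double≢suc-double q (a + b) (trans (sym (suc-injective e)) sum))
  where
  sum : suc (a * 2) + b * 2 ≡ suc ((a + b) * 2)
  sum = solve (a ∷ b ∷ [])

sortedProduct-step : ∀ r h → suc (suc h) ≤ ceilHalf r →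
                     sortedProduct r (suc h) < sortedProduct r (suc (suc h))
sortedProduct-step r h ssh≤⌈r/2⌉ with parityView r
... | even q = sortedProduct-even-step q h (subst (suc (suc h) ≤_) (ceilHalf-even q) ssh≤⌈r/2⌉)
... | odd q = sortedProduct-odd-step q h (s≤s⁻¹ (subst (suc (suc h) ≤_) (ceilHalf-odd q) ssh≤⌈r/2⌉))

sortedProduct-strictMono : ∀ r {h h′} → h < h′ → suc h′ ≤ ceilHalf r →
                           sortedProduct r (suc h) < sortedProduct r (suc h′)
sortedProduct-strictMono r {h} {suc h′} h<sh′ sh′≤⌈r/2⌉ with m≤n⇒m<n∨m≡n (s≤s⁻¹ h<sh′)
... | inj₂ refl = sortedProduct-step r h sh′≤⌈r/2⌉
... | inj₁ h<h′ = <-trans (sortedProduct-strictMono r h<h′ (<⇒≤ sh′≤⌈r/2⌉))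
                          (sortedProduct-step r h′ sh′≤⌈r/2⌉)

sortedProduct-≤ : ∀ r h → suc h ≤ ceilHalf r → sortedProduct r (suc h) ≤ fib (r ∸ 2)
sortedProduct-≤ r h sh≤⌈r/2⌉ with sortedProduct-product r h sh≤⌈r/2⌉
... | i , j , refl , e = subst (_≤ fib (i + j ∸ 1)) (sym e) (fib-product-≤ i j)

sortedProduct-mono : ∀ r {h h′} → h ≤ h′ → suc h′ ≤ ceilHalf r →
                     sortedProduct r (suc h) ≤ sortedProduct r (suc h′)
sortedProduct-mono r h≤h′ sh′≤⌈r/2⌉ with m≤n⇒m<n∨m≡n h≤h′
... | inj₁ h<h′ = <⇒≤ (sortedProduct-strictMono r h<h′ sh′≤⌈r/2⌉)
... | inj₂ refl = ≤-refl

-- Stern's sequence and the rows of the diatomic array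

private
  half-< : ∀ n → suc (suc n) / 2 < suc (suc n)
  half-< n = m/n<m (suc (suc n)) 2 (s≤s (s≤s z≤n))

  half+1-< : ∀ n → suc (suc (suc n)) / 2 + 1 < suc (suc (suc n))
  half+1-< n = begin-strict
    suc (suc (suc n)) / 2 + 1  ≡⟨ +-comm (suc (suc (suc n)) / 2) 1 ⟩
    suc (suc (suc (suc n)) / 2) ≡⟨ cong suc (m/n≡1+[m∸n]/n {suc (suc (suc n))} {2} (s≤s (s≤s z≤n))) ⟩
    suc (suc (suc n / 2))      <⟨ s≤s (s≤s (m/n<m (suc n) 2 (s≤s (s≤s z≤n)))) ⟩
    suc (suc (suc n))          ∎
    where open ≤-Reasoning

sternF-fuel : ∀ {f g} n → n < f → n < g → sternF f n ≡ sternF g n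
sternF-fuel {suc f} {suc g} 0 _ _ = refl
sternF-fuel {suc f} {suc g} 1 _ _ = refl
sternF-fuel {suc f} {suc g} 2 (s≤s 1<f) (s≤s 1<g) = sternF-fuel 1 1<f 1<g
sternF-fuel {suc f} {suc g} n@(suc (suc (suc m))) (s≤s n≤f) (s≤s n≤g) with n % 2
... | zero = sternF-fuel (n / 2) (<-≤-trans (half-< (suc m)) n≤f) (<-≤-trans (half-< (suc m)) n≤g)
... | suc _ = cong₂ _+_
  (sternF-fuel (n / 2) (<-≤-trans (half-< (suc m)) n≤f) (<-≤-trans (half-< (suc m)) n≤g))
  (sternF-fuel (n / 2 + 1) (<-≤-trans (half+1-< m) n≤f) (<-≤-trans (half+1-< m) n≤g))

stern-fuel : ∀ {f} n → n < f → sternF f n ≡ stern n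
stern-fuel n n<f = sternF-fuel n n<f ≤-refl

private
  sternF-even : ∀ f n → suc (suc n) % 2 ≡ 0 →
                sternF (suc f) (suc (suc n)) ≡ sternF f (suc (suc n) / 2)
  sternF-even f n _ with suc (suc n) % 2
  sternF-even f n refl | zero = refl

  sternF-odd : ∀ f n → suc (suc n) % 2 ≡ 1 →
               sternF (suc f) (suc (suc n)) ≡ sternF f (suc (suc n) / 2) + sternF f (suc (suc n) / 2 + 1)
  sternF-odd f n _ with suc (suc n) % 2
  sternF-odd f n refl | suc zero = refl

stern-double : ∀ n → stern (n * 2) ≡ stern n
stern-double zero = refl
stern-double (suc n) = begin
  stern (suc n * 2)                       ≡⟨ sternF-even _ (n * 2) (m*n%n≡0 (suc n) 2) ⟩
  sternF (suc n * 2) (suc n * 2 / 2)      ≡⟨ cong (sternF (suc n * 2)) (m*n/n≡m (suc n) 2) ⟩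
  sternF (suc n * 2) (suc n)              ≡⟨ stern-fuel (suc n) (s≤s (s≤s (m≤m*n n 2))) ⟩
  stern (suc n)                           ∎
  where open ≡-Reasoning

stern-double-suc : ∀ n → stern (suc (n * 2)) ≡ stern n + stern (suc n)
stern-double-suc zero = refl
stern-double-suc (suc n) = begin
  stern (suc (suc n * 2))
    ≡⟨ sternF-odd _ (suc (n * 2)) ([m+kn]%n≡m%n 1 (suc n) 2) ⟩
  sternF f (suc (suc n * 2) / 2) + sternF f (suc (suc n * 2) / 2 + 1)
    ≡⟨ cong (λ h → sternF f h + sternF f (h + 1)) (suc-double/2 (suc n)) ⟩
  sternF f (suc n) + sternF f (suc n + 1)
    ≡⟨ cong (λ m → sternF f (suc n) + sternF f m) (+-comm (suc n) 1) ⟩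
  sternF f (suc n) + sternF f (suc (suc n))
    ≡⟨ cong₂ _+_ (stern-fuel (suc n) (s≤s (s≤s (≤-trans (m≤m*n n 2) (n≤1+n _)))))
                 (stern-fuel (suc (suc n)) (s≤s (s≤s (s≤s (m≤m*n n 2))))) ⟩
  stern (suc n) + stern (suc (suc n)) ∎
  where
  open ≡-Reasoning
  f : ℕ
  f = suc (suc (suc (n * 2)))

stern-2^ : ∀ k → stern (2 ^ k) ≡ 1
stern-2^ zero = refl
stern-2^ (suc k) = trans (cong stern (*-comm 2 (2 ^ k))) (trans (stern-double (2 ^ k)) (stern-2^ k))

data Deficit (k a b x y : ℕ) : Set where
  ascending  : a + x ≡ fib (suc k) → b + y ≡ fib (2 + k) → Deficit k a b x y
  descending : b + x ≡ fib (suc k) → a + y ≡ fib (2 + k) → Deficit k a b x y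

deficit-total : ∀ {k a b x y} → Deficit k a b x y → (a + b) + (x + y) ≡ fib (3 + k)
deficit-total {k} {a} {b} {x} {y} (ascending a+x b+y) = begin
  (a + b) + (x + y)  ≡⟨ solve (a ∷ b ∷ x ∷ y ∷ []) ⟩
  (b + y) + (a + x)  ≡⟨ cong₂ _+_ b+y a+x ⟩
  fib (3 + k)        ∎
  where open ≡-Reasoning
deficit-total {k} {a} {b} {x} {y} (descending b+x a+y) = begin
  (a + b) + (x + y)  ≡⟨ solve (a ∷ b ∷ x ∷ y ∷ []) ⟩
  (a + y) + (b + x)  ≡⟨ cong₂ _+_ a+y b+x ⟩
  fib (3 + k)        ∎
  where open ≡-Reasoning

deficit-first-≤ : ∀ {k a b x y} → Deficit k a b x y → a ≤ fib (2 + k)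
deficit-first-≤ {k} {a} {x = x} (ascending a+x _) =
  ≤-trans (m≤m+n a x) (≤-trans (≤-reflexive a+x) (fib-≤-suc (suc k)))
deficit-first-≤ {a = a} {y = y} (descending _ a+y) = ≤-trans (m≤m+n a y) (≤-reflexive a+y)

private
  deficit-step : ∀ k a x → a + x ≡ fib (suc k) → a + (fib k + x) ≡ fib (2 + k)
  deficit-step k a x a+x = begin
    a + (fib k + x)    ≡⟨ cong (_+_ a) (+-comm (fib k) x) ⟩
    a + (x + fib k)    ≡⟨ +-assoc a x (fib k) ⟨
    a + x + fib k      ≡⟨ cong (_+ fib k) a+x ⟩
    fib (2 + k)        ∎
    where open ≡-Reasoning

deficit-children : ∀ {k a b x y} → Deficit k a b x y →
    (Deficit (suc k) a (a + b) (fib k + x) (x + y) × Deficit (suc k) (a + b) b y (x + y))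
  ⊎ (Deficit (suc k) a (a + b) y (x + y) × Deficit (suc k) (a + b) b (fib k + x) (x + y))
deficit-children {k} {a} {b} {x} d@(ascending a+x b+y) =
  inj₁ (ascending (deficit-step k a x a+x) (deficit-total d) , descending b+y (deficit-total d))
deficit-children {k} {a} {b} {x} d@(descending b+x a+y) =
  inj₂ (ascending a+y (deficit-total d) , descending (deficit-step k b x b+x) (deficit-total d))

PairDeficit : ℕ → ℕ → ℕ → ℕ → Set
PairDeficit k u x y = Deficit k (stern (2 ^ k + u)) (stern (suc (2 ^ k + u))) x y

private
  child-position : ∀ k u → 2 ^ suc k + u * 2 ≡ (2 ^ k + u) * 2
  child-position k u = lemma (2 ^ k) u
    where
    lemma : ∀ p u → 2 * p + u * 2 ≡ (p + u) * 2
    lemma = solve-∀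

  stern-left : ∀ k u → stern (2 ^ suc k + u * 2) ≡ stern (2 ^ k + u)
  stern-left k u = trans (cong stern (child-position k u)) (stern-double (2 ^ k + u))

  stern-middle : ∀ k u → stern (suc (2 ^ suc k + u * 2)) ≡ stern (2 ^ k + u) + stern (suc (2 ^ k + u))
  stern-middle k u = trans (cong (λ n → stern (suc n)) (child-position k u)) (stern-double-suc (2 ^ k + u))

  stern-middle′ : ∀ k u → stern (2 ^ suc k + suc (u * 2)) ≡ stern (2 ^ k + u) + stern (suc (2 ^ k + u))
  stern-middle′ k u = trans (cong stern (+-suc (2 ^ suc k) (u * 2))) (stern-middle k u)

  stern-right : ∀ k u → stern (suc (2 ^ suc k + suc (u * 2))) ≡ stern (suc (2 ^ k + u))
  stern-right k u = trans (cong (λ n → stern (suc n)) position) (stern-double (suc (2 ^ k + u)))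
    where
    position : 2 ^ suc k + suc (u * 2) ≡ suc ((2 ^ k + u) * 2)
    position = trans (+-suc (2 ^ suc k) (u * 2)) (cong suc (child-position k u))

  deficit-cong : ∀ {k a a′ b b′ x y} → a ≡ a′ → b ≡ b′ → Deficit k a b x y → Deficit k a′ b′ x y
  deficit-cong refl refl d = d

pair-children : ∀ k u {x y} → PairDeficit k u x y →
    (PairDeficit (suc k) (u * 2) (fib k + x) (x + y) × PairDeficit (suc k) (suc (u * 2)) y (x + y))
  ⊎ (PairDeficit (suc k) (u * 2) y (x + y) × PairDeficit (suc k) (suc (u * 2)) (fib k + x) (x + y))
pair-children k u d = Sum.map (Product.map left right) (Product.map left right) (deficit-children d)
  where
  a : ℕ
  a = stern (2 ^ k + u)
  b : ℕ
  b = stern (suc (2 ^ k + u))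
  left : ∀ {x y} → Deficit (suc k) a (a + b) x y → PairDeficit (suc k) (u * 2) x y
  left = deficit-cong (sym (stern-left k u)) (sym (stern-middle k u))
  right : ∀ {x y} → Deficit (suc k) (a + b) b x y → PairDeficit (suc k) (suc (u * 2)) x y
  right = deficit-cong (sym (stern-middle′ k u)) (sym (stern-right k u))

private
  fib-scaled-step : ∀ c t {x y} → y ≡ c * fib t → x + y ≡ c * fib (suc t) →
                    y + (x + y) ≡ c * fib (suc (suc t))
  fib-scaled-step c t {x} {y} y≡ x+y≡ = begin
    y + (x + y)                  ≡⟨ cong₂ _+_ y≡ x+y≡ ⟩
    c * fib t + c * fib (suc t)  ≡⟨ *-distribˡ-+ c (fib t) (fib (suc t)) ⟨
    c * (fib t + fib (suc t))    ≡⟨ cong (c *_) (+-comm (fib t) (fib (suc t))) ⟩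
    c * fib (suc (suc t))        ∎
    where open ≡-Reasoning

  spread : ∀ f x s → f + (s + s) ≤ f + x + s + s
  spread f x s = begin
    f + (s + s)      ≤⟨ m≤m+n _ x ⟩
    f + (s + s) + x  ≡⟨ solve (f ∷ x ∷ s ∷ []) ⟩
    f + x + s + s    ∎
    where open ≤-Reasoning

-- The deficits occurring in row k: (0, 0), F (i + 1) times (F (t − 1), F t) with
-- (i + 1) + (t + 1) = k, and pairs whose sum is at least F (k − 1).
data Admissible : ℕ → ℕ → ℕ → Set where
  zero-deficit    : ∀ {k} → Admissible k 0 0
  product-deficit : ∀ {k x y} i t → suc i + suc t ≡ k →
                    y ≡ fib (suc i) * fib t → x + y ≡ fib (suc i) * fib (suc t) → Admissible k x y
  large-deficit   : ∀ {k x y} → fib k ≤ x + y → fib (suc k) ≤ x + y + y → Admissible (suc k) x y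

admissible-good : ∀ {k x y} → Admissible k x y → Admissible (suc k) y (x + y)
admissible-good zero-deficit = zero-deficit
admissible-good (product-deficit i t level y≡ x+y≡) =
  product-deficit i (suc t) (trans (+-suc (suc i) (suc t)) (cong suc level)) x+y≡
                  (fib-scaled-step (fib (suc i)) t y≡ x+y≡)
admissible-good {suc k} {x} {y} (large-deficit x+y≥ x+2y≥) =
  large-deficit (≤-trans x+2y≥ (≤-reflexive rotate)) (begin
    fib (suc k) + fib k          ≤⟨ +-mono-≤ x+2y≥ x+y≥ ⟩
    x + y + y + (x + y)          ≡⟨ cong (_+ (x + y)) rotate ⟩
    y + (x + y) + (x + y)        ∎)
  where
  open ≤-Reasoning
  rotate : x + y + y ≡ y + (x + y)
  rotate = solve (x ∷ y ∷ [])

admissible-bad : ∀ {k x y} → Admissible k x y → Admissible (suc k) (fib k + x) (x + y)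
admissible-bad {zero} zero-deficit = zero-deficit
admissible-bad {suc k} zero-deficit =
  product-deficit k 0 (+-comm (suc k) 1) (sym (*-zeroʳ (fib (suc k)))) (unit (fib (suc k)))
  where
  unit : ∀ f → f + 0 + 0 ≡ f * 1
  unit = solve-∀
admissible-bad {x = x} {y} (product-deficit i t refl y≡ x+y≡) =
  large-deficit (≤-trans (m≤m+n _ x) (m≤m+n _ (x + y))) (begin
    fib-k + fib (i + suc t)        ≤⟨ +-monoʳ-≤ fib-k deficit-bound ⟩
    fib-k + ((x + y) + (x + y))    ≤⟨ spread fib-k x (x + y) ⟩
    fib-k + x + (x + y) + (x + y)  ∎)
  where
  open ≤-Reasoning
  fib-k : ℕ
  fib-k = fib (suc i + suc t)
  deficit-bound : fib (i + suc t) ≤ (x + y) + (x + y)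
  deficit-bound = begin
    fib (i + suc t)                          ≡⟨ cong fib (+-suc i t) ⟩
    fib (suc (i + t))                        ≤⟨ fib-≤-double-product i t ⟩
    2 * (fib (suc i) * fib (suc t))          ≡⟨ cong (λ p → p + (p + 0)) x+y≡ ⟨
    (x + y) + ((x + y) + 0)                  ≡⟨ cong (_+_ (x + y)) (+-identityʳ (x + y)) ⟩
    (x + y) + (x + y)                        ∎
admissible-bad {suc k} {x} {y} (large-deficit x+y≥ _) =
  large-deficit (≤-trans (m≤m+n _ x) (m≤m+n _ (x + y))) (begin
    fib (suc k) + fib k                ≤⟨ +-monoʳ-≤ (fib (suc k)) x+y≥ ⟩
    fib (suc k) + (x + y)              ≤⟨ +-monoʳ-≤ (fib (suc k)) (m≤m+n (x + y) (x + y)) ⟩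
    fib (suc k) + ((x + y) + (x + y))  ≤⟨ spread (fib (suc k)) x (x + y) ⟩
    fib (suc k) + x + (x + y) + (x + y) ∎)
  where open ≤-Reasoning

private
  halve-< : ∀ k u → u * 2 < 2 ^ suc k → u < 2 ^ k
  halve-< k u lt = *-cancelʳ-< 2 u (2 ^ k) (subst (u * 2 <_) (*-comm 2 (2 ^ k)) lt)

  suc-double-< : ∀ k u → u < 2 ^ k → suc (u * 2) < 2 ^ suc k
  suc-double-< k u lt = subst (suc (u * 2) <_) (*-comm (2 ^ k) 2) (*-monoˡ-≤ 2 lt)

  double-< : ∀ k u → u < 2 ^ k → u * 2 < 2 ^ suc k
  double-< k u lt = <-trans (n<1+n _) (suc-double-< k u lt)

AdmissiblePair : ℕ → ℕ → Set
AdmissiblePair k u = ∃[ x ] ∃[ y ] (PairDeficit k u x y × Admissible k x y)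

children-admissible : ∀ k u → AdmissiblePair k u →
                      AdmissiblePair (suc k) (u * 2) × AdmissiblePair (suc k) (suc (u * 2))
children-admissible k u (x , y , d , adm) with pair-children k u d
... | inj₁ (bad , good) = (_ , _ , bad , admissible-bad adm) , (_ , _ , good , admissible-good adm)
... | inj₂ (good , bad) = (_ , _ , good , admissible-good adm) , (_ , _ , bad , admissible-bad adm)

pair-admissible : ∀ k u → u < 2 ^ k → AdmissiblePair k u
pair-admissible zero zero _ = 0 , 0 , ascending refl refl , zero-deficit
pair-admissible zero (suc u) (s≤s ())
pair-admissible (suc k) u′ u′<2^k with parityView u′
... | even u = proj₁ (children-admissible k u (pair-admissible k u (halve-< k u u′<2^k)))
... | odd u = proj₂ (children-admissible k u (pair-admissible k u (halve-< k u (<-trans (n<1+n _) u′<2^k))))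

Reachable : ℕ → ℕ → ℕ → Set
Reachable k x y = ∃[ u ] (u < 2 ^ k × PairDeficit k u x y)

reachable-children : ∀ {k x y} → Reachable k x y →
                     Reachable (suc k) y (x + y) × Reachable (suc k) (fib k + x) (x + y)
reachable-children {k} (u , u<2^k , d) with pair-children k u d
... | inj₁ (bad , good) = (suc (u * 2) , suc-double-< k u u<2^k , good) , (u * 2 , double-< k u u<2^k , bad)
... | inj₂ (good , bad) = (u * 2 , double-< k u u<2^k , good) , (suc (u * 2) , suc-double-< k u u<2^k , bad)

reachable-zero : ∀ k → Reachable k 0 0
reachable-zero zero = 0 , s≤s z≤n , ascending refl refl
reachable-zero (suc k) = proj₁ (reachable-children (reachable-zero k))

reachable-product : ∀ i t → ∃[ x ] ∃[ y ]
  (Reachable (suc (t + i)) x y × y ≡ fib i * fib t × x + y ≡ fib i * fib (suc t))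
reachable-product i zero =
  _ , _ , proj₂ (reachable-children (reachable-zero i)) , sym (*-zeroʳ (fib i)) , unit (fib i)
  where
  unit : ∀ f → f + 0 + (0 + 0) ≡ f * 1
  unit = solve-∀
reachable-product i (suc t) with reachable-product i t
... | x , y , reach , y≡ , x+y≡ =
  y , x + y , proj₁ (reachable-children reach) , x+y≡ , fib-scaled-step (fib i) t y≡ x+y≡

∈-row : ∀ r t → t ≤ 2 ^ r → stern (2 ^ r + t) ∈ row r
∈-row r t t≤2^r = ∈-map⁺ (λ t → stern (2 ^ r + t)) (∈-upTo⁺ (s≤s t≤2^r))

row-∈ : ∀ {r v} → v ∈ row r → ∃[ t ] (t ≤ 2 ^ r × v ≡ stern (2 ^ r + t))
row-∈ {r} v∈ with ∈-map⁻ (λ t → stern (2 ^ r + t)) v∈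
... | t , t∈ , v≡ = t , s≤s⁻¹ (∈-upTo⁻ t∈) , v≡

row-≤ : ∀ k {v} → v ∈ row k → v ≤ fib (2 + k)
row-≤ k v∈ with row-∈ {k} v∈
... | t , t≤2^k , refl with m≤n⇒m<n∨m≡n t≤2^k
...   | inj₁ t<2^k with pair-admissible k t t<2^k
...     | _ , _ , d , _ = deficit-first-≤ d
row-≤ k v∈ | t , _ , refl | inj₂ refl = ≤-trans (≤-reflexive last) (fib-pos (suc k))
  where
  last : stern (2 ^ k + 2 ^ k) ≡ 1
  last = trans (cong (λ n → stern (2 ^ k + n)) (sym (+-identityʳ (2 ^ k)))) (stern-2^ (suc k))

private
  middle-total : ∀ k u {x y} → PairDeficit k u x y → stern (2 ^ suc k + suc (u * 2)) + (x + y) ≡ fib (3 + k)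
  middle-total k u {x} {y} d = trans (cong (_+ (x + y)) (stern-middle′ k u)) (deficit-total d)

  fib-pred-≤ : ∀ k → fib (k ∸ 1) ≤ fib (suc k)
  fib-pred-≤ zero = z≤n
  fib-pred-≤ (suc k) = m≤n+m (fib k) (fib (suc k))

row-value-from-deficit : ∀ {k x y} → Reachable k x y → ∃[ v ] (v ∈ row (suc k) × v + (x + y) ≡ fib (3 + k))
row-value-from-deficit {k} (u , u<2^k , d) =
  _ , ∈-row (suc k) (suc (u * 2)) (<⇒≤ (suc-double-< k u u<2^k)) , middle-total k u d

row-value-product : ∀ k i j → i + j ≡ k → ∃[ v ] (v ∈ row (suc k) × v + fib i * fib j ≡ fib (3 + k))
row-value-product k i zero _ with row-value-from-deficit (reachable-zero k)
... | v , v∈ , total = v , v∈ , trans (cong (_+_ v) (*-zeroʳ (fib i))) total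
row-value-product k i (suc t) refl with reachable-product i t
... | x , y , reach , _ , x+y≡
  with row-value-from-deficit (subst (λ l → Reachable l x y) (trans (cong suc (+-comm t i)) (sym (+-suc i t))) reach)
...   | v , v∈ , total = v , v∈ , trans (cong (_+_ v) (sym x+y≡)) total

row-value-cases : ∀ k {v} → v ∈ row (suc k) →
                  (∃[ i ] ∃[ j ] (i + j ≡ k × v + fib i * fib j ≡ fib (3 + k)))
                  ⊎ v + fib (k ∸ 1) ≤ fib (3 + k)
row-value-cases k v∈ with row-∈ {suc k} v∈
... | t , t≤2^sk , refl with parityView t
...   | even u = inj₂ (begin
  stern (2 ^ suc k + u * 2) + fib (k ∸ 1) ≡⟨ cong (_+ fib (k ∸ 1)) (stern-left k u) ⟩
  stern (2 ^ k + u) + fib (k ∸ 1)         ≤⟨ +-mono-≤ (row-≤ k (∈-row k u u≤2^k)) (fib-pred-≤ k) ⟩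
  fib (3 + k)                             ∎)
  where
  open ≤-Reasoning
  u≤2^k : u ≤ 2 ^ k
  u≤2^k = *-cancelʳ-≤ u (2 ^ k) 2 (subst (u * 2 ≤_) (*-comm 2 (2 ^ k)) t≤2^sk)
...   | odd u with pair-admissible k u (halve-< k u t≤2^sk)
...     | _ , _ , d , zero-deficit = inj₁ (0 , k , refl , middle-total k u d)
...     | _ , _ , d , product-deficit i t level _ x+y≡ =
  inj₁ (suc i , suc t , level ,
        trans (cong (_+_ (stern (2 ^ suc k + suc (u * 2)))) (sym x+y≡)) (middle-total k u d))
...     | x , y , d , large-deficit x+y≥ _ =
  inj₂ (≤-trans (+-monoʳ-≤ _ x+y≥) (≤-reflexive (middle-total k u d)))

-- Counting the larger values of a row

length-deduplicate : ∀ xs {ys : List ℕ} → Unique ys →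
                     (∀ {z} → z ∈ xs → z ∈ ys) → (∀ {z} → z ∈ ys → z ∈ xs) →
                     length (deduplicate _≟_ xs) ≡ length ys
length-deduplicate xs uniq xs⊆ys ys⊆xs = ↭-length (∼bag⇒↭ (unique∧set⇒bag (deduplicate-! xs) uniq
  (mk⇔ (xs⊆ys ∘ ∈-deduplicate⁻ _≟_ xs) (∈-deduplicate⁺ _≟_ ∘ ys⊆xs))))

numLarger-≡ : ∀ r v n (f : ℕ → ℕ) → (∀ {i j} → i < j → j < n → f i ≢ f j) →
              (∀ {z} → z ∈ row r → v < z → ∃[ i ] (i < n × z ≡ f i)) →
              (∀ {i} → i < n → f i ∈ row r × v < f i) →
              numLarger r v ≡ n
numLarger-≡ r v n f injective larger⊆ larger⊇ =
  trans (length-deduplicate (filter (v <?_) (row r)) (applyUpTo⁺₁ f n injective) ⊆ ⊇) (length-applyUpTo f n)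
  where
  ⊆ : ∀ {z} → z ∈ filter (v <?_) (row r) → z ∈ applyUpTo f n
  ⊆ z∈ with ∈-filter⁻ (v <?_) z∈
  ... | z∈row , v<z with larger⊆ z∈row v<z
  ...   | i , i<n , refl = ∈-applyUpTo⁺ f i<n
  ⊇ : ∀ {z} → z ∈ applyUpTo f n → z ∈ filter (v <?_) (row r)
  ⊇ z∈ with ∈-applyUpTo⁻ f z∈
  ... | i , i<n , refl = ∈-filter⁺ (v <?_) (proj₁ (larger⊇ i<n)) (proj₂ (larger⊇ i<n))

private
  ∸-from-total : ∀ {a b c} → a + b ≡ c → a ≡ c ∸ b
  ∸-from-total {a} {b} refl = sym (m+n∸n≡m a b)

  smaller-summand : ∀ {a b c d} → a + b ≡ c + d → a < c → d < b
  smaller-summand {a} {b} {c} {d} eq a<c = +-cancelˡ-< a d b (begin-strict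
    a + d  <⟨ +-monoˡ-< d a<c ⟩
    c + d  ≡⟨ eq ⟨
    a + b  ∎)
    where open ≤-Reasoning

  larger-summand : ∀ {a b c d} → a + b ≡ c + d → d < b → a < c
  larger-summand {a} {b} {c} {d} eq d<b = +-cancelʳ-< b a c (begin-strict
    a + b  ≡⟨ eq ⟩
    c + d  <⟨ +-monoʳ-< c d<b ⟩
    c + b  ∎)
    where open ≤-Reasoning

row-value-sortedProduct : ∀ k h → suc h ≤ ceilHalf (suc k) →
                          ∃[ w ] (w ∈ row (suc k) × w + sortedProduct (suc k) (suc h) ≡ fib (3 + k))
row-value-sortedProduct k h bound with sortedProduct-product (suc k) h bound
... | i , j , i+j<r , P≡ with row-value-product k i j (suc-injective i+j<r)
...   | w , w∈ , total = w , w∈ , trans (cong (_+_ w) P≡) total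

larger-row-value : ∀ k h {v z} → suc h ≤ ceilHalf (suc k) →
                   v + sortedProduct (suc k) (suc h) ≡ fib (3 + k) → z ∈ row (suc k) → v < z →
                   ∃[ h′ ] (h′ < h × z + sortedProduct (suc k) (suc h′) ≡ fib (3 + k))
larger-row-value k h {v} {z} sh≤⌈r/2⌉ v-total z∈ v<z with row-value-cases k z∈
... | inj₂ z+F≤F = contradiction (begin-strict
  v + P h          <⟨ +-monoˡ-< (P h) v<z ⟩
  z + P h          ≤⟨ +-monoʳ-≤ z (sortedProduct-≤ (suc k) h sh≤⌈r/2⌉) ⟩
  z + fib (k ∸ 1)  ≤⟨ z+F≤F ⟩
  fib (3 + k)      ≡⟨ v-total ⟨
  v + P h          ∎) (<-irrefl refl)
  where
  open ≤-Reasoning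
  P : ℕ → ℕ
  P h′ = sortedProduct (suc k) (suc h′)
... | inj₁ (i , j , i+j≡k , z-total) with product-sortedProduct (suc k) i j (cong suc i+j≡k)
...   | h′ , bound′ , F≡P = h′ , h′<h , z-total′
  where
  z-total′ : z + sortedProduct (suc k) (suc h′) ≡ fib (3 + k)
  z-total′ = trans (cong (_+_ z) (sym F≡P)) z-total
  h′<h : h′ < h
  h′<h = ≰⇒> (λ h≤h′ → <⇒≱ (smaller-summand (trans v-total (sym z-total′)) v<z)
                            (sortedProduct-mono (suc k) h≤h′ bound′))

sortedProduct-isL : ∀ k h → suc h ≤ ceilHalf (suc k) →
                    ∃[ v ] (IsL (suc k) (suc h) v × v + sortedProduct (suc k) (suc h) ≡ fib (3 + k))
sortedProduct-isL k h sh≤⌈r/2⌉ with row-value-sortedProduct k h sh≤⌈r/2⌉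
... | v , v∈ , v-total = v , (v∈ , cong suc (numLarger-≡ r v h value injective larger⊆ larger⊇)) , v-total
  where
  r : ℕ
  r = suc k
  value : ℕ → ℕ
  value h′ = fib (3 + k) ∸ sortedProduct r (suc h′)

  below : ∀ {h′} → h′ < h → suc h′ ≤ ceilHalf r
  below h′<h = ≤-trans h′<h (≤-trans (n≤1+n h) sh≤⌈r/2⌉)

  sortedProduct-≤-fib : ∀ {h′} → suc h′ ≤ ceilHalf r → sortedProduct r (suc h′) ≤ fib (3 + k)
  sortedProduct-≤-fib bound with row-value-sortedProduct k _ bound
  ... | w , _ , total = ≤-trans (m≤n+m _ w) (≤-reflexive total)

  injective : ∀ {i j} → i < j → j < h → value i ≢ value j
  injective i<j j<h eq = <⇒≢ (sortedProduct-strictMono r i<j (below j<h))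
    (∸-cancelˡ-≡ (sortedProduct-≤-fib (below (<-trans i<j j<h))) (sortedProduct-≤-fib (below j<h)) eq)

  larger⊆ : ∀ {z} → z ∈ row r → v < z → ∃[ h′ ] (h′ < h × z ≡ value h′)
  larger⊆ z∈ v<z with larger-row-value k h sh≤⌈r/2⌉ v-total z∈ v<z
  ... | h′ , h′<h , z-total = h′ , h′<h , ∸-from-total z-total

  larger⊇ : ∀ {h′} → h′ < h → value h′ ∈ row r × v < value h′
  larger⊇ {h′} h′<h with row-value-sortedProduct k h′ (below h′<h)
  ... | w , w∈ , w-total = subst (λ x → x ∈ row r × v < x) (∸-from-total w-total)
    (w∈ , larger-summand (trans v-total (sym w-total)) (sortedProduct-strictMono r h′<h sh≤⌈r/2⌉))

private
  integer-difference : ∀ {a b c} → a + b ≡ c → + a ≡ + c - + b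
  integer-difference {a} {b} refl = cancel (+ a) (+ b)
    where
    cancel : ∀ x y → x ≡ x ℤ.+ y - y
    cancel = ℤ-Solver.solve-∀

theorem1p1 : (r : ℕ) →
    ((m : ℕ) → 1 ≤ m → m ≤ ceilHalf r →
      ∃[ v ] IsL r m v × ∃[ i ] ∃[ j ] (suc (i + j) ≡ r × + v ≡ + fib (r + 2) - + (fib i * fib j)))
    × ((i j : ℕ) → suc (i + j) ≡ r →
      ∃[ m ] (1 ≤ m × m ≤ ceilHalf r × ∃[ v ] (IsL r m v × + v ≡ + fib (r + 2) - + (fib i * fib j))))
    × ((m : ℕ) → 1 ≤ m → m ≤ ceilHalf r →
      ∃[ v ] (IsL r m v × + v ≡ + fib (r + 2) - + (fib (2 * m ∸ 2 ∸ bTerm r m) * fib (r + 1 + bTerm r m ∸ 2 * m))))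
theorem1p1 zero = (λ { (suc m) _ () }) , (λ i j ()) , (λ { (suc m) _ () })
theorem1p1 r@(suc k) = by-product , by-index , L
  where
  L : ∀ m → 1 ≤ m → m ≤ ceilHalf r →
      ∃[ v ] (IsL r m v × + v ≡ + fib (r + 2) - + sortedProduct r m)
  L (suc h) _ bound with sortedProduct-isL k h bound
  ... | v , isL , total = v , isL , integer-difference (trans total (cong fib (+-comm 2 r)))

  by-product : ∀ m → 1 ≤ m → m ≤ ceilHalf r →
               ∃[ v ] IsL r m v × ∃[ i ] ∃[ j ] (suc (i + j) ≡ r × + v ≡ + fib (r + 2) - + (fib i * fib j))
  by-product m@(suc h) 1≤m bound with L m 1≤m bound | sortedProduct-product r h bound
  ... | v , isL , v≡ | i , j , i+j<r , P≡ =
    v , isL , i , j , i+j<r , trans v≡ (cong (λ p → + fib (r + 2) - + p) P≡)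

  by-index : ∀ i j → suc (i + j) ≡ r →
             ∃[ m ] (1 ≤ m × m ≤ ceilHalf r × ∃[ v ] (IsL r m v × + v ≡ + fib (r + 2) - + (fib i * fib j)))
  by-index i j i+j<r with product-sortedProduct r i j i+j<r
  ... | h , bound , F≡P with L (suc h) (s≤s z≤n) bound
  ...   | v , isL , v≡ =
    suc h , s≤s z≤n , bound , v , isL , trans v≡ (cong (λ p → + fib (r + 2) - + p) (sym F≡P))
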